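{- Let $G$ be a ONE-ONE-LQ instance and $M$ a minimal feasible matching in $G$. Algorithm EXTEND (described in the context) applied to $(G,M)$ outputs a matching $M'$ with $M\subseteq M'$ such that, if $M'$ is envy-free in $G$, then $M'$ is a maximum-size envy-free matching of $G$ among all envy-free matchings of $G$ containing $M$.
   Context: ONE-ONE-LQ instance: bipartite graph $G=(\mathcal{A}\cup\mathcal{B},E)$ of agents and resources, each vertex with a strict preference order over its neighbours ($\succ_u$), each resource with upper-quota $1$ and lower-quota in $\{0,1\}$ (LQ resource if lower-quota $1$). Matching: each vertex in at most one edge; $M(v)$ partner or $\bot$ (least preferred). Feasible: every LQ resource matched. Minimal feasible: feasible, and deleting any edge gives an infeasible matching. Blocking pair $(a,b)\in E\setminus M$: $b\succ_a M(a)$ and $a\succ_b M(b)$; stable: no blocking pair. Envy: $a$ envies matched $a'$ with $M(a')=b$ if $(a,b)\in E$, $b\succ_a M(a)$, $a\succ_b a'$; envy-free: no envy. In an instance without lower quotas, the agent-optimal stable matching is the stable matching in which every agent is matched at least as well as in any other stable matching (it is produced by agent-proposing Gale–Shapley). Algorithm EXTEND$(G,M)$: for every resource $b$ unmatched in $M$, its threshold agent $t(b)$ is the most preferred (by $b$) agent $a$ in $b$'s list that is matched in $M$ with $b\succ_a M(a)$; if none exists, $t(b)$ is a dummy agent placed at the end of $b$'s list. Let $G''$ be the subgraph with edge set $\{(a,b)\in E: a,b \text{ unmatched in } M,\ a\succ_b t(b)\}$, all lower quotas $0$, upper quotas $1$, and preferences of $G$ restricted to neighbours in $G''$. Compute the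 agent-optimal stable matching $M_s$ of $G''$ and output $M'=M\cup M_s$. -}

module Defs where

open import Data.Nat using (ℕ; _<_; _≤_)
open import Data.Fin using (Fin; _≟_)
open import Data.Bool using (Bool; true; false)
open import Data.Maybe using (Maybe; just; nothing; is-just)
open import Data.List using (List; length; filterᵇ; allFin)
open import Data.Product using (Σ; _×_; _,_; ∃)
open import Data.Unit using (⊤)
open import Relation.Binary.PropositionalEquality using (_≡_)
open import Relation.Nullary using (¬_; yes; no)

-- Agents are Fin nA, resources are Fin nB.
-- Strict preferences are given by rank functions (smaller rank = more
-- preferred), required to be injective on the neighbourhood of each vertex,
-- so they induce a strict total order on the neighbours.  All upper quotas
-- are 1; 'lq b ≡ true' means b is an LQ resource (lower quota 1).

record Instance : Set where
  field
    nA nB : ℕ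
    adj   : Fin nA → Fin nB → Bool
    rankA : Fin nA → Fin nB → ℕ
    rankB : Fin nB → Fin nA → ℕ
    rankA-inj : ∀ a b b' → adj a b ≡ true → adj a b' ≡ true →
                rankA a b ≡ rankA a b' → b ≡ b'
    rankB-inj : ∀ b a a' → adj a b ≡ true → adj a' b ≡ true →
                rankB b a ≡ rankB b a' → a ≡ a'
    lq    : Fin nB → Bool

open Instance public

Edge : (G : Instance) → Fin (nA G) → Fin (nB G) → Set
Edge G a b = adj G a b ≡ true

Assignment : ℕ → ℕ → Set
Assignment nA nB = Fin nA → Maybe (Fin nB)

_⊆M_ : ∀ {nA nB} → Assignment nA nB → Assignment nA nB → Set
M ⊆M N = ∀ a b → M a ≡ just b → N a ≡ just b

size : ∀ {nA nB} → Assignment nA nB → ℕ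
size {nA} M = length (filterᵇ (λ a → is-just (M a)) (allFin nA))

-- union of two assignments (M takes precedence; used for vertex-disjoint M, Ms)
_∪M_ : ∀ {nA nB} → Assignment nA nB → Assignment nA nB → Assignment nA nB
(M ∪M Ms) a with M a
... | just b  = just b
... | nothing = Ms a

deleteAt : ∀ {nA nB} → Assignment nA nB → Fin nA → Assignment nA nB
deleteAt M a x with x ≟ a
... | yes _ = nothing
... | no _  = M x

module _ {nA nB : ℕ} (E : Fin nA → Fin nB → Set)
         (rA : Fin nA → Fin nB → ℕ) (rB : Fin nB → Fin nA → ℕ) where

  IsMatching : Assignment nA nB → Set
  IsMatching M = (∀ a b → M a ≡ just b → E a b)
               × (∀ a a' b → M a ≡ just b → M a' ≡ just b → a ≡ a')

  PrefA : Fin nA → Fin nB → Maybe (Fin nB) → Set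
  PrefA a b nothing   = ⊤
  PrefA a b (just b') = rA a b < rA a b'

  PrefB : Assignment nA nB → Fin nB → Fin nA → Set
  PrefB M b a = ∀ a' → M a' ≡ just b → rB b a < rB b a'

  BlockingPair : Assignment nA nB → Fin nA → Fin nB → Set
  BlockingPair M a b = E a b × ¬ (M a ≡ just b) × PrefA a b (M a) × PrefB M b a

  Stable : Assignment nA nB → Set
  Stable M = IsMatching M × (∀ a b → ¬ BlockingPair M a b)

  AgentOptimalStable : Assignment nA nB → Set
  AgentOptimalStable Ms =
    Stable Ms ×
    (∀ N → Stable N → ∀ a b → N a ≡ just b →
       Σ (Fin nB) λ b' → (Ms a ≡ just b') × (rA a b' ≤ rA a b))

  Envies : Assignment nA nB → Fin nA → Fin nA → Set
  Envies M a a' = Σ (Fin nB) λ b → (M a' ≡ just b) × E a b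
                  × PrefA a b (M a) × (rB b a < rB b a')

  EnvyFree : Assignment nA nB → Set
  EnvyFree M = ∀ a a' → ¬ Envies M a a'

Matching : (G : Instance) → Assignment (nA G) (nB G) → Set
Matching G = IsMatching (Edge G) (rankA G) (rankB G)

EnvyFreeIn : (G : Instance) → Assignment (nA G) (nB G) → Set
EnvyFreeIn G = EnvyFree (Edge G) (rankA G) (rankB G)

Feasible : (G : Instance) → Assignment (nA G) (nB G) → Set
Feasible G M = Matching G M × (∀ b → lq G b ≡ true → ∃ λ a → M a ≡ just b)

MinimalFeasible : (G : Instance) → Assignment (nA G) (nB G) → Set
MinimalFeasible G M = Feasible G M × (∀ a b → M a ≡ just b → ¬ Feasible G (deleteAt M a))

module _ (G : Instance) (M : Assignment (nA G) (nB G)) where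

  UnmatchedA : Fin (nA G) → Set
  UnmatchedA a = M a ≡ nothing

  UnmatchedB : Fin (nB G) → Set
  UnmatchedB b = ∀ a → ¬ (M a ≡ just b)

  -- candidates for the threshold t(b): agents a' adjacent to b, matched in M,
  -- with b ≻_{a'} M(a')
  ThresholdCandidate : Fin (nB G) → Fin (nA G) → Set
  ThresholdCandidate b a' = Edge G a' b ×
    Σ (Fin (nB G)) λ b' → (M a' ≡ just b') × (rankA G a' b < rankA G a' b')

  -- a ≻_b t(b): t(b) is the b-most-preferred candidate (or a dummy at the end
  -- of b's list if there is none), so a ≻_b t(b) iff a is preferred by b
  -- to every candidate.
  AboveThreshold : Fin (nA G) → Fin (nB G) → Set
  AboveThreshold a b = ∀ a' → ThresholdCandidate b a' → rankB G b a < rankB G b a'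

  E'' : Fin (nA G) → Fin (nB G) → Set
  E'' a b = Edge G a b × UnmatchedA a × UnmatchedB b × AboveThreshold a b

  -- Ms is the matching computed by EXTEND in G'' (agent-optimal stable
  -- matching of G'', which has no lower quotas and the restricted preferences)
  ExtendStep : Assignment (nA G) (nB G) → Set
  ExtendStep Ms = AgentOptimalStable E'' (rankA G) (rankB G) Ms

-- Let S = M ∪ Ms and let N ⊇ M be an envy-free matching.  Charge every agent
-- a matched in N to an agent matched in S: to a itself if a does not prefer
-- N(a) to S(a).  Otherwise b = N(a) and a are both unmatched in M, and
-- envy-freeness of N puts a above the threshold of b, so (a,b) is an edge of
-- G''.  Since Ms is stable in G'', b is taken in Ms by an agent a' that b
-- prefers to a, and then envy-freeness of N forces a' to prefer b to N(a');
-- charge a to a'.  The charging is injective, hence |N| ≤ |S|.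

module Submission where

open import Defs
open import Data.Nat using (_≤_)
open import Data.Product using (_×_)

open import Data.Bool using (Bool; T)
open import Data.Bool.Properties using (T?)
open import Data.Empty using (⊥-elim)
open import Data.Fin using (Fin; zero; suc) renaming (_≟_ to _≟ᶠ_)
open import Data.Fin.Properties using (any?; injective⇒≤)
open import Data.List using (List; length; lookup; filterᵇ; allFin)
open import Data.List.Membership.Propositional using (_∈_)
open import Data.List.Membership.Propositional.Properties
  using (∈-filter⁺; ∈-filter⁻; ∈-allFin; ∈-lookup)
open import Data.List.Membership.Setoid.Properties using (index-injective)
open import Data.List.Relation.Unary.All as All using ()
open import Data.List.Relation.Unary.AllPairs using (_∷_)
open import Data.List.Relation.Unary.Any using (index)
open import Data.List.Relation.Unary.Unique.Propositional using (Unique)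
open import Data.List.Relation.Unary.Unique.Propositional.Properties using (allFin⁺; filter⁺)
open import Data.Maybe using (just; nothing; is-just)
open import Data.Maybe.Properties using (≡-dec)
open import Data.Nat using (ℕ; _<_; _<?_)
open import Data.Nat.Properties using (<-irrefl; ≮⇒≥; ≤∧≢⇒<)
open import Data.Product using (∃; _,_; proj₁; proj₂)
open import Data.Sum using (_⊎_; inj₁; inj₂)
open import Data.Unit using (tt)
open import Function using (_∘_)
open import Relation.Nullary using (¬_; Dec; yes; no)
open import Relation.Nullary.Decidable using (map′; ¬?; _×-dec_; decidable-stable)
open import Relation.Binary.PropositionalEquality

lookup-injective : ∀ {A : Set} {xs : List A} → Unique xs →
  ∀ i j → lookup xs i ≡ lookup xs j → i ≡ j
lookup-injective (_ ∷ _)      zero    zero    _  = refl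
lookup-injective (x≢xs ∷ _)   zero    (suc j) eq =
  ⊥-elim (All.lookup x≢xs (∈-lookup j) eq)
lookup-injective (x≢xs ∷ _)   (suc i) zero    eq =
  ⊥-elim (All.lookup x≢xs (∈-lookup i) (sym eq))
lookup-injective (_ ∷ xs-uniq) (suc i) (suc j) eq = cong suc (lookup-injective xs-uniq i j eq)

count-mono-injective : ∀ {n} (p q : Fin n → Bool) (f : Fin n → Fin n) →
  (∀ x → T (p x) → T (q (f x))) →
  (∀ x y → T (p x) → T (p y) → f x ≡ f y → x ≡ y) →
  length (filterᵇ p (allFin n)) ≤ length (filterᵇ q (allFin n))
count-mono-injective {n} p q f f-into f-inj = injective⇒≤ {f = g} g-injective
  where
  xs ys : List (Fin n)
  xs = filterᵇ p (allFin n)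
  ys = filterᵇ q (allFin n)

  p-lookup : ∀ i → T (p (lookup xs i))
  p-lookup i = proj₂ (∈-filter⁻ (T? ∘ p) {xs = allFin n} (∈-lookup i))

  image∈ys : ∀ i → f (lookup xs i) ∈ ys
  image∈ys i = ∈-filter⁺ (T? ∘ q) (∈-allFin _) (f-into _ (p-lookup i))

  g : Fin (length xs) → Fin (length ys)
  g i = index (image∈ys i)

  g-injective : ∀ {i j} → g i ≡ g j → i ≡ j
  g-injective {i} {j} eq = lookup-injective (filter⁺ (T? ∘ p) (allFin⁺ n)) i j
    (f-inj _ _ (p-lookup i) (p-lookup j)
      (index-injective (setoid (Fin n)) (image∈ys i) (image∈ys j) eq))

⊆M-∪M : ∀ {nA nB} (M Ms : Assignment nA nB) → M ⊆M (M ∪M Ms)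
⊆M-∪M M Ms a b eq with M a
... | just _ = eq

∪M-unmatched : ∀ {nA nB} (M Ms : Assignment nA nB) a →
  M a ≡ nothing → (M ∪M Ms) a ≡ Ms a
∪M-unmatched M Ms a eq with M a
... | nothing = refl

∪M-cases : ∀ {nA nB} (M Ms : Assignment nA nB) a b → (M ∪M Ms) a ≡ just b →
  M a ≡ just b ⊎ (M a ≡ nothing × Ms a ≡ just b)
∪M-cases M Ms a b eq with M a
... | just _  = inj₁ eq
... | nothing = inj₂ (refl , eq)

module Preferences {nA nB : ℕ} (E : Fin nA → Fin nB → Set)
         (rA : Fin nA → Fin nB → ℕ) (rB : Fin nB → Fin nA → ℕ) where

  prefA-irrefl : ∀ {a b} → ¬ PrefA E rA rB a b (just b)
  prefA-irrefl = <-irrefl refl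

  prefA? : ∀ a b m → Dec (PrefA E rA rB a b m)
  prefA? a b nothing  = yes tt
  prefA? a b (just c) = rA a b <? rA a c

  stable⇒held-by-rival : ∀ {Ms} → Stable E rA rB Ms → ∀ {a b} →
    E a b → PrefA E rA rB a b (Ms a) →
    ∃ λ a' → Ms a' ≡ just b × ¬ rB b a < rB b a'
  stable⇒held-by-rival {Ms} (_ , no-blocking) {a} {b} eab pref
    with any? (λ a' → ≡-dec _≟ᶠ_ (Ms a') (just b) ×-dec ¬? (rB b a <? rB b a'))
  ... | yes rival = rival
  ... | no no-rival = ⊥-elim (no-blocking a b (eab , Msa≢b , pref , b-prefers-a))
    where
    Msa≢b : ¬ Ms a ≡ just b
    Msa≢b eq = prefA-irrefl (subst (PrefA E rA rB a b) eq pref)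

    b-prefers-a : PrefB E rA rB Ms b a
    b-prefers-a a' eq = decidable-stable (_ <? _) (λ ≮ → no-rival (a' , eq , ≮))

  module _ (S N : Assignment nA nB) where

    Improves Content : Fin nA → Set
    Improves a = ∃ λ b → N a ≡ just b × PrefA E rA rB a b (S a)
    Content  a = ∃ λ b → N a ≡ just b × ¬ PrefA E rA rB a b (S a)

    improves? : ∀ a → Dec (Improves a)
    improves? a with N a
    ... | nothing = no λ { (_ , () , _) }
    ... | just b  = map′ (λ p → b , refl , p) (λ { (_ , refl , p) → p }) (prefA? a b (S a))

    content⇒matched : ∀ {a} → Content a → T (is-just (S a))
    content⇒matched {a} (b , _ , ¬pref) with S a
    ... | nothing = ¬pref tt
    ... | just _  = tt

    size≤-by-displacement :
      (∀ a a' b → N a ≡ just b → N a' ≡ just b → a ≡ a') →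
      (∀ a → Improves a → ∃ λ a' → ¬ Content a' × S a' ≡ N a) →
      size N ≤ size S
    size≤-by-displacement N-injective displace =
      count-mono-injective _ _ charge charge-matched charge-injective
      where
      charge : Fin nA → Fin nA
      charge a with improves? a
      ... | yes imp = proj₁ (displace a imp)
      ... | no _    = a

      charge-spec : ∀ a b → N a ≡ just b →
        (¬ Content (charge a) × S (charge a) ≡ N a) ⊎ (Content a × charge a ≡ a)
      charge-spec a b Na with improves? a
      ... | yes imp = inj₁ (proj₂ (displace a imp))
      ... | no ¬imp = inj₂ ((b , Na , λ p → ¬imp (b , Na , p)) , refl)

      matched : ∀ a → T (is-just (N a)) → ∃ λ b → N a ≡ just b
      matched a _ with N a
      ... | just b = b , refl

      charge-matched : ∀ a → T (is-just (N a)) → T (is-just (S (charge a)))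
      charge-matched a t with matched a t
      ... | b , Na with charge-spec a b Na
      ...   | inj₁ (_ , held) = subst (T ∘ is-just) (sym held) t
      ...   | inj₂ (content , same) =
              subst (T ∘ is-just ∘ S) (sym same) (content⇒matched content)

      charge-injective : ∀ x y → T (is-just (N x)) → T (is-just (N y)) →
        charge x ≡ charge y → x ≡ y
      charge-injective x y tx ty eq with matched x tx | matched y ty
      ... | bx , Nx | by , Ny with charge-spec x bx Nx | charge-spec y by Ny
      ...   | inj₁ (_ , Sx) | inj₁ (_ , Sy) =
              N-injective x y bx Nx (trans (sym Sy) (trans (cong S (sym eq)) (trans Sx Nx)))
      ...   | inj₂ (_ , x≡) | inj₂ (_ , y≡) = trans (sym x≡) (trans eq y≡)
      ...   | inj₁ (¬content , _) | inj₂ (content , y≡) =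
              ⊥-elim (¬content (subst Content (sym (trans eq y≡)) content))
      ...   | inj₂ (content , x≡) | inj₁ (¬content , _) =
              ⊥-elim (¬content (subst Content (trans (sym x≡) eq) content))

module _ (G : Instance) where

  open Preferences (Edge G) (rankA G) (rankB G)

  private
    Prefers = PrefA (Edge G) (rankA G) (rankB G)

  rankA-≮⇒> : ∀ {a b b'} → Edge G a b → Edge G a b' → ¬ b ≡ b' →
    ¬ rankA G a b' < rankA G a b → rankA G a b < rankA G a b'
  rankA-≮⇒> {a} {b} {b'} e e' b≢b' ≮ =
    ≤∧≢⇒< (≮⇒≥ ≮) (b≢b' ∘ rankA-inj G a b b' e e')

  rankB-≮⇒> : ∀ {b a a'} → Edge G a b → Edge G a' b → ¬ a ≡ a' →
    ¬ rankB G b a' < rankB G b a → rankB G b a < rankB G b a'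
  rankB-≮⇒> {b} {a} {a'} e e' a≢a' ≮ =
    ≤∧≢⇒< (≮⇒≥ ≮) (a≢a' ∘ rankB-inj G b a a' e e')

  ∪M-matching : ∀ {M Ms} → Matching G M →
    IsMatching (E'' G M) (rankA G) (rankB G) Ms → Matching G (M ∪M Ms)
  ∪M-matching {M} {Ms} (M-edges , M-inj) (Ms-edges , Ms-inj) = edges , injective
    where
    edges : ∀ a b → (M ∪M Ms) a ≡ just b → Edge G a b
    edges a b eq with ∪M-cases M Ms a b eq
    ... | inj₁ Ma       = M-edges a b Ma
    ... | inj₂ (_ , Msa) = proj₁ (Ms-edges a b Msa)

    Ms-avoids-M : ∀ a a' b → Ms a ≡ just b → ¬ M a' ≡ just b
    Ms-avoids-M a a' b Msa = proj₁ (proj₂ (proj₂ (Ms-edges a b Msa))) a'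

    injective : ∀ a a' b → (M ∪M Ms) a ≡ just b → (M ∪M Ms) a' ≡ just b → a ≡ a'
    injective a a' b e e' with ∪M-cases M Ms a b e | ∪M-cases M Ms a' b e'
    ... | inj₁ Ma         | inj₁ Ma'         = M-inj a a' b Ma Ma'
    ... | inj₂ (_ , Msa)  | inj₂ (_ , Msa')  = Ms-inj a a' b Msa Msa'
    ... | inj₁ Ma         | inj₂ (_ , Msa')  = ⊥-elim (Ms-avoids-M a' a b Msa' Ma)
    ... | inj₂ (_ , Msa)  | inj₁ Ma'         = ⊥-elim (Ms-avoids-M a a' b Msa Ma')

  module _ {M Ms : Assignment (nA G) (nB G)} (extend : ExtendStep G M Ms)
           {N : Assignment (nA G) (nB G)} (N-matching : Matching G N)
           (M⊆N : M ⊆M N) (N-envy-free : EnvyFreeIn G N) where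

    private
      S = M ∪M Ms
      N-edge = proj₁ N-matching
      N-inj  = proj₂ N-matching
      Ms-stable = proj₁ extend
      Ms-edge = proj₁ (proj₁ Ms-stable)

    matched-in-M⇒¬improves : ∀ {a c} → M a ≡ just c → ¬ Improves S N a
    matched-in-M⇒¬improves {a} {c} Ma (b , Na , pref) with trans (sym Na) (M⊆N a c Ma)
    ... | refl = prefA-irrefl (subst (Prefers a b) (⊆M-∪M M Ms a b Ma) pref)

    improver-unmatched : ∀ {a} → Improves S N a → M a ≡ nothing
    improver-unmatched {a} improves = by-cases (M a) refl
      where
      by-cases : ∀ m → M a ≡ m → M a ≡ nothing
      by-cases nothing  Ma = Ma
      by-cases (just c) Ma = ⊥-elim (matched-in-M⇒¬improves Ma improves)

    target-unmatched : ∀ {a b} → N a ≡ just b → M a ≡ nothing → UnmatchedB G M b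
    target-unmatched {a} {b} Na Ma a' Ma' with N-inj a a' b Na (M⊆N a' b Ma')
    ... | refl with trans (sym Ma) Ma'
    ...   | ()

    -- A threshold candidate a' keeps its M-partner in N, so it would envy a
    -- if b preferred it to a.
    above-threshold : ∀ {a b} → N a ≡ just b → M a ≡ nothing → AboveThreshold G M a b
    above-threshold {a} {b} Na Ma a' (ea'b , b' , Ma' , b≻b') =
      rankB-≮⇒> (N-edge a b Na) ea'b a≢a'
        (λ a'≻a → N-envy-free a' a
          (b , Na , ea'b , subst (Prefers a' b) (sym (M⊆N a' b' Ma')) b≻b' , a'≻a))
      where
      a≢a' : ¬ a ≡ a'
      a≢a' refl with trans (sym Ma) Ma'
      ... | ()

    Ms⊆S : Ms ⊆M S
    Ms⊆S a b Msa = trans (∪M-unmatched M Ms a (proj₁ (proj₂ (Ms-edge a b Msa)))) Msa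

    improver-edge : ∀ {a b} → N a ≡ just b → Improves S N a → E'' G M a b
    improver-edge Na improves =
      N-edge _ _ Na , Ma , target-unmatched Na Ma , above-threshold Na Ma
      where
      Ma = improver-unmatched improves

    rival-discontent : ∀ {a a' b} → N a ≡ just b → Ms a' ≡ just b →
      rankB G b a' < rankB G b a → ¬ Content S N a'
    rival-discontent {a} {a'} {b} Na Msa' b-prefers-a' (b₂ , Na'b₂ , ¬pref) =
      N-envy-free a' a
        (b , Na , ea'b , subst (Prefers a' b) (sym Na'b₂) b≻b₂ , b-prefers-a')
      where
      ea'b = proj₁ (Ms-edge a' b Msa')

      b₂≢b : ¬ b₂ ≡ b
      b₂≢b refl with N-inj a' a b₂ Na'b₂ Na
      ... | refl = <-irrefl refl b-prefers-a'

      b≻b₂ : rankA G a' b < rankA G a' b₂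
      b≻b₂ = rankA-≮⇒> ea'b (N-edge a' b₂ Na'b₂) (b₂≢b ∘ sym)
               (¬pref ∘ subst (Prefers a' b₂) (sym (Ms⊆S a' b Msa')))

    improver-prefers-over-Ms : ∀ {a} ((b , _ , _) : Improves S N a) → Prefers a b (Ms a)
    improver-prefers-over-Ms {a} improves@(b , _ , pref) =
      subst (Prefers a b) (∪M-unmatched M Ms a (improver-unmatched improves)) pref

    improver-displaced : ∀ a → Improves S N a →
      ∃ λ a' → ¬ Content S N a' × S a' ≡ N a
    improver-displaced a improves@(b , Na , _)
      with Preferences.stable⇒held-by-rival (E'' G M) (rankA G) (rankB G)
             Ms-stable (improver-edge Na improves) (improver-prefers-over-Ms improves)
    ... | a' , Msa' , ≮ =
      a' , rival-discontent Na Msa' b-prefers-a' , trans (Ms⊆S a' b Msa') (sym Na)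
      where
      a'≢a : ¬ a' ≡ a
      a'≢a refl = prefA-irrefl (subst (Prefers a b) Msa' (improver-prefers-over-Ms improves))

      b-prefers-a' : rankB G b a' < rankB G b a
      b-prefers-a' = rankB-≮⇒> (proj₁ (Ms-edge a' b Msa')) (N-edge a b Na) a'≢a ≮

    extension-size-bound : size N ≤ size S
    extension-size-bound = size≤-by-displacement S N N-inj improver-displaced

-- Envy-freeness of M ∪M Ms is what makes it a competitor; the bound itself
-- holds for every envy-free N ⊇ M, and minimality of M is only used through
-- M being a matching.
corollary3 : (G : Instance) (M : Assignment (nA G) (nB G)) →
    MinimalFeasible G M →
    (Ms : Assignment (nA G) (nB G)) → ExtendStep G M Ms →
    Matching G (M ∪M Ms) × (M ⊆M (M ∪M Ms)) ×
    (EnvyFreeIn G (M ∪M Ms) →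
      (N : Assignment (nA G) (nB G)) → Matching G N → M ⊆M N → EnvyFreeIn G N →
      size N ≤ size (M ∪M Ms))
corollary3 G M ((M-matching , _) , _) Ms extend =
  ∪M-matching G M-matching (proj₁ (proj₁ extend)) ,
  ⊆M-∪M M Ms ,
  λ _ N N-matching M⊆N N-envy-free →
    extension-size-bound G extend N-matching M⊆N N-envy-free
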